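{- Let $d\ge 1$ be an integer. There is no online algorithm with advice for online unit clustering in $\mathbb{R}^d$ which serves optimally all request sequences of length at least $n$ while reading fewer than $\frac{d\log_2 3}{1+4d}\cdot n$ bits of advice on each of them; that is, any online algorithm with advice that serves every request sequence optimally must, for arbitrarily large $n$, read at least $\frac{d\log_2 3}{1+4d}\cdot n$ bits of advice on some request sequence of $n$ points.
   Context: Online unit clustering in $\mathbb{R}^d$: points of $\mathbb{R}^d$ with the $L_\infty$ norm arrive one by one; upon arrival each point must be irrevocably assigned to a cluster (an existing one or a newly opened one), and every cluster must have $L_\infty$-diameter at most $1$ (i.e. fit in an axis-parallel unit cube). The cost is the number of clusters; serving a sequence optimally means using the offline minimum number of clusters. Online algorithm with advice (tape model): an oracle knowing the whole input writes an infinite binary advice tape, which the algorithm may read sequentially; the advice complexity is the number of bits read. -}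

module Defs where

open import Data.Nat as ℕ using (ℕ; zero; suc; _<_; _≤_; _^_; _*_; _+_)
open import Data.Rational as ℚ using (ℚ; ∣_∣; _-_; 1ℚ)
open import Data.Fin using (Fin; toℕ)
open import Data.List using (List; []; _∷_; _++_; [_]; length; lookup; take; tabulate; deduplicate)
open import Data.Bool using (Bool)
open import Data.Product using (_×_)
open import Relation.Binary.PropositionalEquality using (_≡_)

Point : ℕ → Set
Point d = Fin d → ℚ

-- L∞ distance at most 1 (i.e. the two points fit in a common unit cube).
Close : ∀ {d} → Point d → Point d → Set
Close p q = ∀ k → ℚ._≤_ ∣ p k - q k ∣ 1ℚ

Seq : ℕ → Set
Seq d = List (Point d)

ValidClustering : ∀ {d} {A : Set} (σ : Seq d) → (Fin (length σ) → A) → Set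
ValidClustering σ f = ∀ i j → f i ≡ f j → Close (lookup σ i) (lookup σ j)

Tape : Set
Tape = ℕ → Bool

-- Online algorithm with advice (tape model).
-- assign σ τ : cluster label given to the LAST point of the (non-empty) prefix σ,
--              seen only the prefix σ and advice τ.
-- reads  σ τ : total number of advice bits read after processing prefix σ.
record OnlineAlg (d : ℕ) : Set where
  field
    assign : Seq d → Tape → ℕ
    reads  : Seq d → Tape → ℕ
    local  : ∀ σ τ τ' → (∀ i → i < reads σ τ → τ i ≡ τ' i) →
             (reads σ τ' ≡ reads σ τ) × (assign σ τ' ≡ assign σ τ)
    mono   : ∀ σ p τ → reads σ τ ≤ reads (σ ++ [ p ]) τ

module _ {d : ℕ} (A : OnlineAlg d) where
  open OnlineAlg A

  -- Label of the i-th request when running A on σ with advice τ (irrevocable: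
  -- computed when only the prefix up to i is known).
  labels : (σ : Seq d) → Tape → Fin (length σ) → ℕ
  labels σ τ i = assign (take (suc (toℕ i)) σ) τ

  cost : Seq d → Tape → ℕ
  cost σ τ = length (deduplicate ℕ._≟_ (tabulate (labels σ τ)))

  ServesOptimally : Seq d → Tape → Set
  ServesOptimally σ τ =
    ValidClustering σ (labels σ τ) ×
    (∀ k (g : Fin (length σ) → Fin k) → ValidClustering σ g → cost σ τ ≤ k)

  AlwaysOptimal : Set
  AlwaysOptimal = ∀ σ → Data.Product.∃ λ τ → ServesOptimally σ τ

-- b ≥ (d log₂ 3 / (1 + 4d)) · n   ⇔   2^(b·(1+4d)) ≥ 3^(d·n)
AtLeastBound : (d n b : ℕ) → Set
AtLeastBound d n b = 3 ^ (d * n) ≤ 2 ^ (b * (1 + 4 * d))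

{-# OPTIONS --safe #-}
module Submission where

-- All requests lie on the main diagonal, where the L∞ distance is that of a single coordinate;
-- positions are natural numbers in units of ¼, so a cluster spans at most 4 units.  A request
-- sequence is a row of m gadgets of five requests, 20 units apart, each of one of four types.
-- Every gadget needs two clusters and no cluster meets two gadgets, so an optimal clustering
-- uses 2m clusters, exactly two per gadget.  Any two gadget types share their first requests,
-- yet every optimal clustering of one of them treats these common requests differently from
-- every optimal clustering of the other.  An online algorithm labels the common requests before
-- the types diverge, so with the same advice it cannot serve two different type sequences
-- optimally: the 4^m sequences need pairwise different advice, hence 2m bits for some
-- sequence of 5m requests, which beats the bound since 3⁵ ≤ 2⁸.

open import Defs
open import Data.Bool using (false)
open import Data.Empty using (⊥-elim)
open import Data.Fin as Fin using (Fin; toℕ)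
open import Data.Fin.Patterns using (0F; 1F; 2F; 3F; 4F)
import Data.Fin.Properties as Fin
open import Data.List using (List; []; _∷_; _++_; [_]; length; lookup; take; drop; tabulate; deduplicate)
open import Data.List.Membership.Propositional using (_∈_)
open import Data.List.Membership.Propositional.Properties using (∈-deduplicate⁺; ∈-tabulate⁺)
open import Data.List.Properties using (length-tabulate)
import Data.List.Properties as List
import Data.List.Relation.Unary.Any as Any
open import Data.List.Relation.Unary.Any.Properties using (lookup-index)
open import Data.Nat as ℕ using (ℕ; zero; suc; _+_; _*_; _∸_; _^_; _≤_; _<_; z≤n; s≤s; _≤?_)
import Data.Nat.Properties as ℕ
open import Data.Nat.Solver using (module +-*-Solver)
open +-*-Solver using (solve; _:+_; _:*_; _:=_; con)
open import Data.Product as Product using (_×_; _,_; ∃; proj₁; proj₂; uncurry)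
open import Data.Rational as ℚ using (ℚ; 0ℚ; 1ℚ; _-_; ∣_∣; normalize)
import Data.Rational.Properties as ℚ
open import Algebra.Properties.AbelianGroup ℚ.+-0-abelianGroup using (xyx⁻¹≈y; ⁻¹-anti-homo‿-)
open import Data.Sum using (_⊎_; inj₁; inj₂; [_,_]′)
open import Data.Vec as Vec using (_∷_; [])
import Data.Vec.Functional as Vector
open import Function using (_∘_; Injective; Inverse)
open import Relation.Binary.Definitions using (DecidableEquality; tri<; tri≈; tri>)
open import Relation.Binary.PropositionalEquality hiding ([_])
open import Relation.Nullary
open import Relation.Nullary.Decidable using (True; False; toWitness; toWitnessFalse; from-yes; _×-dec_; _→-dec_)

injective⇒≤length : ∀ {A : Set} {k} {xs : List A} (f : Fin k → A) →
                    Injective _≡_ _≡_ f → (∀ i → f i ∈ xs) → k ≤ length xs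
injective⇒≤length {k = k} {xs} f f-injective f∈xs = ℕ.≮⇒≥ collision
  where
  stored : ∀ i → f i ≡ lookup xs (Any.index (f∈xs i))
  stored i = lookup-index (f∈xs i)
  collision : ¬ length xs < k
  collision short with i , j , i<j , same ← Fin.pigeonhole short (Any.index ∘ f∈xs) =
    Fin.<⇒≢ i<j (f-injective (trans (stored i) (trans (cong (lookup xs) same) (sym (stored j)))))

∷-injective : ∀ {A B : Set} {n} (ℓ : A → B) {t : A} {f : Fin n → A} → Injective _≡_ _≡_ (ℓ ∘ f) →
              (∀ i → ℓ t ≢ ℓ (f i)) → Injective _≡_ _≡_ (ℓ ∘ (t Vector.∷ f))
∷-injective ℓ f-injective new {Fin.zero}  {Fin.zero}  _    = refl
∷-injective ℓ f-injective new {Fin.zero}  {Fin.suc j} same = ⊥-elim (new j same)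
∷-injective ℓ f-injective new {Fin.suc i} {Fin.zero}  same = ⊥-elim (new i (sym same))
∷-injective ℓ f-injective new {Fin.suc i} {Fin.suc j} same = cong Fin.suc (f-injective same)

remQuot-injective : ∀ {m} k {i j : Fin (m * k)} → Fin.remQuot {m} k i ≡ Fin.remQuot k j → i ≡ j
remQuot-injective {m} k {i} {j} eq =
  trans (sym (Fin.combine-remQuot {m} k i)) (trans (cong (uncurry Fin.combine) eq) (Fin.combine-remQuot {m} k j))

finToFun-injective : ∀ {k n} {u v : Fin (k ^ n)} → (∀ i → Fin.finToFun u i ≡ Fin.finToFun v i) → u ≡ v
finToFun-injective {k} {n} {u} {v} same = begin
  u                                      ≡⟨ Fin.funToFin-finToFin {n} {k} u ⟨
  Fin.funToFin (Fin.finToFun {k} {n} u)  ≡⟨ funToFin-cong {n} same ⟩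
  Fin.funToFin (Fin.finToFun {k} {n} v)  ≡⟨ Fin.funToFin-finToFin {n} {k} v ⟩
  v                                      ∎
  where
  open ≡-Reasoning
  funToFin-cong : ∀ {n} {f g : Fin n → Fin k} → (∀ i → f i ≡ g i) → Fin.funToFin f ≡ Fin.funToFin g
  funToFin-cong {zero}  _    = refl
  funToFin-cong {suc n} same = cong₂ Fin.combine (same Fin.zero) (funToFin-cong (same ∘ Fin.suc))

first-difference : ∀ {n} {A : Set} → DecidableEquality A → (f g : Fin n → A) →
                   (∀ i → f i ≡ g i) ⊎ ∃ λ j → f j ≢ g j × (∀ i → i Fin.< j → f i ≡ g i)
first-difference _≟_ f g with Fin.all? (λ i → f i ≟ g i)
... | yes f≗g = inj₁ f≗g
... | no f≉g with j , f≢g , below ← Fin.¬∀⟶∃¬-smallest _ _ (λ i → f i ≟ g i) f≉g =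
  inj₂ (j , f≢g , λ i i<j → subst (λ i → f i ≡ g i) (inject-fromℕ< i<j) (below (Fin.fromℕ< i<j)))
  where
  inject-fromℕ< : ∀ {i} (i<j : i Fin.< j) → Fin.inject (Fin.fromℕ< i<j) ≡ i
  inject-fromℕ< i<j = Fin.toℕ-injective (trans (Fin.toℕ-inject _) (Fin.toℕ-fromℕ< i<j))

take-tabulate-cong : ∀ {A : Set} {n} k (f g : Fin n → A) → (∀ i → toℕ i < k → f i ≡ g i) →
                     take k (tabulate f) ≡ take k (tabulate g)
take-tabulate-cong             zero    f g agree = refl
take-tabulate-cong {n = zero}  (suc k) f g agree = refl
take-tabulate-cong {n = suc n} (suc k) f g agree = cong₂ _∷_ (agree Fin.zero (s≤s z≤n))
  (take-tabulate-cong k (f ∘ Fin.suc) (g ∘ Fin.suc) λ i i<k → agree (Fin.suc i) (s≤s i<k))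

lookup-tabulate′ : ∀ {A : Set} {n} (f : Fin n → A) i → lookup (tabulate f) i ≡ f (Fin.cast (length-tabulate f) i)
lookup-tabulate′ {n = n} f i = begin
  lookup (tabulate f) i                                     ≡⟨ cong (lookup (tabulate f)) (Fin.cast-involutive (sym eq) eq i) ⟨
  lookup (tabulate f) (Fin.cast (sym eq) (Fin.cast eq i))   ≡⟨ List.lookup-tabulate f (Fin.cast eq i) ⟩
  f (Fin.cast eq i)                                         ∎
  where
  open ≡-Reasoning
  eq : length (tabulate f) ≡ n
  eq = length-tabulate f

2^[1+2n]<4^[1+n] : ∀ n → 2 ^ suc (n * 2) < 4 ^ suc n
2^[1+2n]<4^[1+n] n = begin-strict
  2 * 2 ^ (n * 2)   ≡⟨ cong (λ e → 2 * 2 ^ e) (ℕ.*-comm n 2) ⟩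
  2 * 2 ^ (2 * n)   ≡⟨ cong (2 *_) (ℕ.^-*-assoc 2 2 n) ⟨
  2 * 4 ^ n         <⟨ ℕ.*-monoˡ-< (4 ^ n) {{ℕ.m^n≢0 4 n}} (ℕ.m<m+n 2 {2} ℕ.z<s) ⟩
  4 * 4 ^ n         ∎
  where open ℕ.≤-Reasoning

≥2m⇒AtLeastBound : ∀ d m b → m * 2 ≤ b → AtLeastBound d (m * 5) b
≥2m⇒AtLeastBound d m b 2m≤b = begin
  3 ^ (d * (m * 5))          ≡⟨ cong (3 ^_) (solve 2 (λ d m → d :* (m :* con 5) := con 5 :* (d :* m)) refl d m) ⟩
  3 ^ (5 * (d * m))          ≡⟨ ℕ.^-*-assoc 3 5 (d * m) ⟨
  (3 ^ 5) ^ (d * m)          ≤⟨ ℕ.^-monoˡ-≤ (d * m) (from-yes (3 ^ 5 ≤? 2 ^ 8)) ⟩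
  (2 ^ 8) ^ (d * m)          ≡⟨ ℕ.^-*-assoc 2 8 (d * m) ⟩
  2 ^ (8 * (d * m))          ≤⟨ ℕ.^-monoʳ-≤ 2 (ℕ.m≤n+m (8 * (d * m)) (m * 2)) ⟩
  2 ^ (m * 2 + 8 * (d * m))  ≡⟨ cong (2 ^_) (solve 2 (λ d m → m :* con 2 :+ con 8 :* (d :* m) := (m :* con 2) :* (con 1 :+ con 4 :* d)) refl d m) ⟩
  2 ^ (m * 2 * (1 + 4 * d))  ≤⟨ ℕ.^-monoʳ-≤ 2 (ℕ.*-monoˡ-≤ (1 + 4 * d) 2m≤b) ⟩
  2 ^ (b * (1 + 4 * d))      ∎
  where open ℕ.≤-Reasoning

-- Points on the diagonal

¼ : ℚ
¼ = normalize 1 4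

quarter : ℕ → ℚ
quarter zero    = 0ℚ
quarter (suc n) = ¼ ℚ.+ quarter n

quarter-+ : ∀ m n → quarter (m + n) ≡ quarter m ℚ.+ quarter n
quarter-+ zero    n = sym (ℚ.+-identityˡ (quarter n))
quarter-+ (suc m) n = trans (cong (¼ ℚ.+_) (quarter-+ m n)) (sym (ℚ.+-assoc ¼ (quarter m) (quarter n)))

quarter-nonNeg : ∀ n → 0ℚ ℚ.≤ quarter n
quarter-nonNeg zero    = ℚ.≤-refl
quarter-nonNeg (suc n) = ℚ.+-mono-≤ (from-yes (0ℚ ℚ.≤? ¼)) (quarter-nonNeg n)

quarter-mono-≤ : ∀ {m n} → m ≤ n → quarter m ℚ.≤ quarter n
quarter-mono-≤ {m} {n} m≤n = begin
  quarter m                      ≡⟨ ℚ.+-identityʳ (quarter m) ⟨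
  quarter m ℚ.+ 0ℚ               ≤⟨ ℚ.+-monoʳ-≤ (quarter m) (quarter-nonNeg (n ∸ m)) ⟩
  quarter m ℚ.+ quarter (n ∸ m)  ≡⟨ quarter-+ m (n ∸ m) ⟨
  quarter (m + (n ∸ m))          ≡⟨ cong quarter (ℕ.m+[n∸m]≡n m≤n) ⟩
  quarter n                      ∎
  where open ℚ.≤-Reasoning

quarter≤1⇒≤4 : ∀ {k} → quarter k ℚ.≤ 1ℚ → k ≤ 4
quarter≤1⇒≤4 {k} k≤1 = ℕ.≮⇒≥ λ 4<k →
  ℚ.<-irrefl refl (ℚ.<-≤-trans (from-yes (1ℚ ℚ.<? quarter 5)) (ℚ.≤-trans (quarter-mono-≤ 4<k) k≤1))

∣p-q∣≡∣q-p∣ : ∀ p q → ∣ p - q ∣ ≡ ∣ q - p ∣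
∣p-q∣≡∣q-p∣ p q = trans (sym (ℚ.∣-p∣≡∣p∣ (p - q))) (cong ∣_∣ (⁻¹-anti-homo‿- p q))

∣quarter-quarter∣ : ∀ m n → ∣ quarter m - quarter n ∣ ≡ quarter ℕ.∣ m - n ∣
∣quarter-quarter∣ m n = [ ordered , reversed ]′ (ℕ.≤-total n m)
  where
  open ≡-Reasoning
  ordered : ∀ {m n} → n ≤ m → ∣ quarter m - quarter n ∣ ≡ quarter ℕ.∣ m - n ∣
  ordered {m} {n} n≤m = begin
    ∣ quarter m - quarter n ∣                       ≡⟨ cong (λ k → ∣ quarter k - quarter n ∣) (ℕ.m+[n∸m]≡n n≤m) ⟨
    ∣ quarter (n + (m ∸ n)) - quarter n ∣           ≡⟨ cong (λ q → ∣ q - quarter n ∣) (quarter-+ n (m ∸ n)) ⟩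
    ∣ quarter n ℚ.+ quarter (m ∸ n) - quarter n ∣   ≡⟨ cong ∣_∣ (xyx⁻¹≈y (quarter n) (quarter (m ∸ n))) ⟩
    ∣ quarter (m ∸ n) ∣                             ≡⟨ ℚ.0≤p⇒∣p∣≡p (quarter-nonNeg (m ∸ n)) ⟩
    quarter (m ∸ n)                                 ≡⟨ cong quarter (ℕ.m≤n⇒∣n-m∣≡n∸m n≤m) ⟨
    quarter ℕ.∣ m - n ∣                             ∎
  reversed : m ≤ n → ∣ quarter m - quarter n ∣ ≡ quarter ℕ.∣ m - n ∣
  reversed m≤n = begin
    ∣ quarter m - quarter n ∣ ≡⟨ ∣p-q∣≡∣q-p∣ (quarter m) (quarter n) ⟩
    ∣ quarter n - quarter m ∣ ≡⟨ ordered m≤n ⟩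
    quarter ℕ.∣ n - m ∣       ≡⟨ cong quarter (ℕ.∣-∣-comm n m) ⟩
    quarter ℕ.∣ m - n ∣       ∎

Near : ℕ → ℕ → Set
Near a b = ℕ.∣ a - b ∣ ≤ 4

near? : ∀ a b → Dec (Near a b)
near? a b = ℕ.∣ a - b ∣ ≤? 4

near-sym : ∀ {a b} → Near a b → Near b a
near-sym {a} {b} = subst (_≤ 4) (ℕ.∣-∣-comm a b)

near-+ : ∀ o {a b} → Near a b → Near (o + a) (o + b)
near-+ o {a} {b} = subst (_≤ 4) (sym (ℕ.∣m+n-m+o∣≡∣n-o∣ o a b))

near-+⁻ : ∀ o {a b} → Near (o + a) (o + b) → Near a b
near-+⁻ o {a} {b} = subst (_≤ 4) (ℕ.∣m+n-m+o∣≡∣n-o∣ o a b)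

onDiagonal : ∀ {d} → ℕ → Point d
onDiagonal a _ = quarter a

-- quarter 4 computes to 1ℚ.
near⇒close : ∀ {d a b} → Near a b → Close {d} (onDiagonal a) (onDiagonal b)
near⇒close {a = a} {b} near _ = subst (ℚ._≤ 1ℚ) (sym (∣quarter-quarter∣ a b)) (quarter-mono-≤ near)

close⇒near : ∀ {d a b} → Fin d → Close (onDiagonal a) (onDiagonal b) → Near a b
close⇒near {a = a} {b} k close = quarter≤1⇒≤4 (subst (ℚ._≤ 1ℚ) (∣quarter-quarter∣ a b) (close k))

-- Advice

open Inverse Fin.2↔Bool using () renaming (to to toBool; from to fromBool; strictlyInverseˡ to toBool-fromBool)

paddedTape : ∀ L → Fin (2 ^ L) → Tape
paddedTape L s i with i ℕ.<? L
... | yes i<L = toBool (Fin.finToFun s (Fin.fromℕ< i<L))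
... | no _    = false

prefixCode : ∀ L → Tape → Fin (2 ^ L)
prefixCode L τ = Fin.funToFin (λ (i : Fin L) → fromBool (τ (toℕ i)))

paddedTape-prefixCode : ∀ L τ {i} → i < L → paddedTape L (prefixCode L τ) i ≡ τ i
paddedTape-prefixCode L τ {i} i<L with i ℕ.<? L
... | no i≮L  = ⊥-elim (i≮L i<L)
... | yes i<L = begin
  toBool (Fin.finToFun (prefixCode L τ) (Fin.fromℕ< i<L)) ≡⟨ cong toBool (Fin.finToFun-funToFin {m = L} (fromBool ∘ τ ∘ toℕ) _) ⟩
  toBool (fromBool (τ (toℕ (Fin.fromℕ< i<L))))           ≡⟨ toBool-fromBool _ ⟩
  τ (toℕ (Fin.fromℕ< i<L))                               ≡⟨ cong τ (Fin.toℕ-fromℕ< i<L) ⟩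
  τ i                                                    ∎
  where open ≡-Reasoning

module _ {k : ℕ} (L : ℕ) (R : Fin k → Tape → Set) (R? : ∀ u τ → Dec (R u τ)) where

  servedWithin? : ∀ u → Dec (∃ λ s → R u (paddedTape L s))
  servedWithin? u = Fin.any? λ s → R? u (paddedTape L s)

  advice-pigeonhole : (∀ {u τ τ′} → (∀ i → i < L → τ i ≡ τ′ i) → R u τ → R u τ′) →
                      (∀ {u u′ τ} → R u τ → R u′ τ → u ≡ u′) →
                      2 ^ L < k → ∃ λ u → ∀ τ → ¬ R u τ
  advice-pigeonhole R-local R-injective 2^L<k with Fin.all? servedWithin?
  ... | yes served
      with u , u′ , u<u′ , same ← Fin.pigeonhole 2^L<k (proj₁ ∘ served) =
    ⊥-elim (Fin.<⇒≢ u<u′ (R-injective (proj₂ (served u)) (subst (R u′ ∘ paddedTape L) (sym same) (proj₂ (served u′)))))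
  ... | no ¬served with u , unserved ← Fin.¬∀⟶∃¬ _ _ servedWithin? ¬served =
    u , λ τ R-u-τ → unserved (prefixCode L τ , R-local (λ i i<L → sym (paddedTape-prefixCode L τ i<L)) R-u-τ)

-- Online algorithms on tabulated request sequences

record Clustering {n} (pos : Fin n → ℕ) (k : ℕ) (ℓ : Fin n → ℕ) : Set where
  field
    near  : ∀ {s t} → ℓ s ≡ ℓ t → Near (pos s) (pos t)
    count : ∀ {r} (h : Fin r → Fin n) → Injective _≡_ _≡_ (ℓ ∘ h) → r ≤ k

valid-tabulate : ∀ {d n} {B : Set} (f : Fin n → Point d) (g : Fin n → B) →
                 (∀ i j → g i ≡ g j → Close (f i) (f j)) →
                 ValidClustering (tabulate f) (g ∘ Fin.cast (length-tabulate f))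
valid-tabulate f g valid i j same =
  subst₂ Close (sym (lookup-tabulate′ f i)) (sym (lookup-tabulate′ f j)) (valid _ _ same)

module _ {d : ℕ} (A : OnlineAlg d) where
  open OnlineAlg A

  ServesWithin : ℕ → Seq d → Tape → Set
  ServesWithin k σ τ = ValidClustering σ (labels A σ τ) × cost A σ τ ≤ k

  servesWithin? : ∀ k σ τ → Dec (ServesWithin k σ τ)
  servesWithin? k σ τ = valid? ×-dec (cost A σ τ ≤? k)
    where
    close? : ∀ p q → Dec (Close {d} p q)
    close? p q = Fin.all? λ c → ∣ p c - q c ∣ ℚ.≤? 1ℚ
    valid? : Dec (ValidClustering σ (labels A σ τ))
    valid? = Fin.all? λ i → Fin.all? λ j →
      (labels A σ τ i ℕ.≟ labels A σ τ j) →-dec close? (lookup σ i) (lookup σ j)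

  optimal⇒servesWithin : ∀ {k σ τ} (g : Fin (length σ) → Fin k) → ValidClustering σ g →
                         ServesOptimally A σ τ → ServesWithin k σ τ
  optimal⇒servesWithin g g-valid (valid , optimal) = valid , optimal _ g g-valid

  reads-++ : ∀ σ ρ τ → reads σ τ ≤ reads (σ ++ ρ) τ
  reads-++ σ []      τ = ℕ.≤-reflexive (cong (λ σ → reads σ τ) (sym (List.++-identityʳ σ)))
  reads-++ σ (p ∷ ρ) τ = ℕ.≤-trans (mono σ p τ)
    (subst (λ σ′ → reads (σ ++ [ p ]) τ ≤ reads σ′ τ) (List.++-assoc σ [ p ] ρ) (reads-++ (σ ++ [ p ]) ρ τ))

  reads-take : ∀ k σ τ → reads (take k σ) τ ≤ reads σ τ
  reads-take k σ τ =
    subst (λ σ′ → reads (take k σ) τ ≤ reads σ′ τ) (List.take++drop≡id k σ) (reads-++ (take k σ) (drop k σ) τ)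

  module _ {σ : Seq d} {τ τ′ : Tape} (agree : ∀ i → i < reads σ τ → τ i ≡ τ′ i) where

    labels-local : ∀ i → labels A σ τ′ i ≡ labels A σ τ i
    labels-local i = proj₂ (local (take _ σ) τ τ′ λ j j< → agree j (ℕ.<-≤-trans j< (reads-take _ σ τ)))

    servesWithin-local : ∀ {k} → ServesWithin k σ τ → ServesWithin k σ τ′
    servesWithin-local {k} (valid , cost≤k) =
      (λ i j same → valid i j (trans (sym (labels-local i)) (trans same (labels-local j)))) ,
      subst (_≤ k) (cong (length ∘ deduplicate ℕ._≟_) (sym (List.tabulate-cong labels-local))) cost≤k

  label : ∀ {n} → (Fin n → Point d) → Tape → Fin n → ℕ
  label f τ i = assign (take (suc (toℕ i)) (tabulate f)) τ

  module _ {n} {f : Fin n → Point d} {τ : Tape} where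

    label≡labels : ∀ i → label f τ i ≡ labels A (tabulate f) τ (Fin.cast (sym (length-tabulate f)) i)
    label≡labels i = cong (λ t → assign (take (suc t) (tabulate f)) τ) (sym (Fin.toℕ-cast _ i))

    label-close : ∀ {k} → ServesWithin k (tabulate f) τ → ∀ {i j} → label f τ i ≡ label f τ j → Close (f i) (f j)
    label-close (valid , _) {i} {j} same = subst₂ Close (List.lookup-tabulate f i) (List.lookup-tabulate f j)
      (valid _ _ (trans (sym (label≡labels i)) (trans same (label≡labels j))))

    label-count : ∀ {k} → ServesWithin k (tabulate f) τ → ∀ {r} (h : Fin r → Fin n) →
                  Injective _≡_ _≡_ (label f τ ∘ h) → r ≤ k
    label-count (_ , cost≤k) h injective = ℕ.≤-trans (injective⇒≤length _ injective used) cost≤k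
      where
      used : ∀ i → label f τ (h i) ∈ deduplicate ℕ._≟_ (tabulate (labels A (tabulate f) τ))
      used i = ∈-deduplicate⁺ ℕ._≟_
        (subst (_∈ tabulate (labels A (tabulate f) τ)) (sym (label≡labels (h i))) (∈-tabulate⁺ _))

  label-prefix : ∀ {n} (f g : Fin n → Point d) τ i → (∀ j → toℕ j ≤ toℕ i → f j ≡ g j) → label f τ i ≡ label g τ i
  label-prefix f g τ i agree = cong (λ σ → assign σ τ) (take-tabulate-cong _ f g λ j j≤i → agree j (ℕ.s≤s⁻¹ j≤i))

  servesWithin⇒clustering : ∀ {n k τ} (pos : Fin n → ℕ) → Fin d → ServesWithin k (tabulate (onDiagonal ∘ pos)) τ →
                            Clustering pos k (label (onDiagonal ∘ pos) τ)
  servesWithin⇒clustering pos coordinate serves = record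
    { near  = λ {s} {t} same → close⇒near {a = pos s} {pos t} coordinate (label-close serves same)
    ; count = label-count serves
    }

-- Gadgets

-- Requests 0 and 1 are common to all types.  Request 2 lies far left of them in types 0 and 1,
-- forcing them into one cluster, and between them in types 2 and 3, forcing them apart; the
-- remaining requests force different clusterings within each pair.  cluster x is an optimal
-- 2-clustering of type x.
gadget : Fin 4 → Fin 5 → ℕ
gadget 0F = Vec.lookup (8 ∷ 10 ∷ 2 ∷ 6 ∷ 0  ∷ [])
gadget 1F = Vec.lookup (8 ∷ 10 ∷ 2 ∷ 6 ∷ 12 ∷ [])
gadget 2F = Vec.lookup (8 ∷ 10 ∷ 9 ∷ 4 ∷ 13 ∷ [])
gadget 3F = Vec.lookup (8 ∷ 10 ∷ 9 ∷ 5 ∷ 14 ∷ [])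

cluster : Fin 4 → Fin 5 → Fin 2
cluster 0F = Vec.lookup (0F ∷ 0F ∷ 1F ∷ 0F ∷ 1F ∷ [])
cluster 1F = Vec.lookup (0F ∷ 0F ∷ 1F ∷ 1F ∷ 0F ∷ [])
cluster 2F = Vec.lookup (0F ∷ 1F ∷ 1F ∷ 0F ∷ 1F ∷ [])
cluster 3F = Vec.lookup (0F ∷ 1F ∷ 0F ∷ 0F ∷ 1F ∷ [])

-- Requests 3 and 4 are far apart in every type, so they represent the two clusters of a gadget.
extreme : Fin 2 → Fin 5
extreme 0F = 3F
extreme 1F = 4F

gadget≤14 : ∀ x r → gadget x r ≤ 14
gadget≤14 = from-yes (Fin.all? λ x → Fin.all? λ r → gadget x r ≤? 14)

cluster⇒near : ∀ x a b → cluster x a ≡ cluster x b → Near (gadget x a) (gadget x b)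
cluster⇒near = from-yes (Fin.all? λ x → Fin.all? λ a → Fin.all? λ b →
  (cluster x a Fin.≟ cluster x b) →-dec near? (gadget x a) (gadget x b))

extremes-apart : ∀ x s s′ → Near (gadget x (extreme s)) (gadget x (extreme s′)) → s ≡ s′
extremes-apart = from-yes (Fin.all? λ x → Fin.all? λ s → Fin.all? λ s′ →
  near? (gadget x (extreme s)) (gadget x (extreme s′)) →-dec (s Fin.≟ s′))

three-in-two : ∀ (a b e : Fin 2) → a ≡ b ⊎ e ≡ a ⊎ e ≡ b
three-in-two 0F 0F _  = inj₁ refl
three-in-two 1F 1F _  = inj₁ refl
three-in-two 0F 1F 0F = inj₂ (inj₁ refl)
three-in-two 0F 1F 1F = inj₂ (inj₂ refl)
three-in-two 1F 0F 0F = inj₂ (inj₂ refl)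
three-in-two 1F 0F 1F = inj₂ (inj₁ refl)

record GadgetClustering (x : Fin 4) (ℓ : Fin 5 → ℕ) : Set where
  field
    near       : ∀ {a b} → ℓ a ≡ ℓ b → Near (gadget x a) (gadget x b)
    two-labels : ∀ r → ∃ λ s → ℓ r ≡ ℓ (extreme s)

module _ {x ℓ} (G : GadgetClustering x ℓ) where
  open GadgetClustering G

  separated : ∀ a b → {False (near? (gadget x a) (gadget x b))} → ℓ a ≢ ℓ b
  separated a b {far} = toWitnessFalse far ∘ near

  forced : ∀ a b e → {False (near? (gadget x e) (gadget x a))} → {False (near? (gadget x e) (gadget x b))} →
           ℓ a ≡ ℓ b
  forced a b e {far-a} {far-b}
    with sa , ha ← two-labels a | sb , hb ← two-labels b | se , he ← two-labels e
    with three-in-two sa sb se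
  ... | inj₁ refl        = trans ha (sym hb)
  ... | inj₂ (inj₁ refl) = ⊥-elim (toWitnessFalse far-a (near (trans he (sym ha))))
  ... | inj₂ (inj₂ refl) = ⊥-elim (toWitnessFalse far-b (near (trans he (sym hb))))

left-joins : ∀ {x ℓ} → GadgetClustering x ℓ → {True (toℕ x ℕ.<? 2)} → ℓ 0F ≡ ℓ 1F
left-joins {0F} G = forced G 0F 1F 2F
left-joins {1F} G = forced G 0F 1F 2F

right-splits : ∀ {x ℓ} → GadgetClustering x ℓ → {True (2 ≤? toℕ x)} → ℓ 0F ≢ ℓ 1F
right-splits {2F} G joined = separated G 1F 3F (trans (sym joined) (forced G 0F 3F 4F))
right-splits {3F} G joined = separated G 1F 3F (trans (sym joined) (forced G 0F 3F 4F))

-- An online algorithm run with the same advice on gadgets of types x and y labels alike every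
-- request before which the two types agree.
record SharedPrefix (x y : Fin 4) (ℓ ℓ′ : Fin 5 → ℕ) : Set where
  field
    agree : ∀ r → (∀ s → toℕ s ≤ toℕ r → gadget x s ≡ gadget y s) → ℓ r ≡ ℓ′ r

SharedPrefix-sym : ∀ {x y ℓ ℓ′} → SharedPrefix x y ℓ ℓ′ → SharedPrefix y x ℓ′ ℓ
SharedPrefix-sym S = record { agree = λ r common → sym (SharedPrefix.agree S r λ s s≤r → sym (common s s≤r)) }

shared : ∀ {x y ℓ ℓ′} → SharedPrefix x y ℓ ℓ′ → ∀ r →
         {True (Fin.all? λ s → (toℕ s ≤? toℕ r) →-dec (gadget x s ℕ.≟ gadget y s))} → ℓ r ≡ ℓ′ r
shared S r {common} = SharedPrefix.agree S r (toWitness common)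

gadget-types-distinguished : ∀ {x y ℓ ℓ′} → GadgetClustering x ℓ → GadgetClustering y ℓ′ →
                             SharedPrefix x y ℓ ℓ′ → x ≡ y
gadget-types-distinguished {0F} {0F} _ _ _ = refl
gadget-types-distinguished {1F} {1F} _ _ _ = refl
gadget-types-distinguished {2F} {2F} _ _ _ = refl
gadget-types-distinguished {3F} {3F} _ _ _ = refl
gadget-types-distinguished {0F} {1F} {ℓ} {ℓ′} G G′ S = ⊥-elim (separated G′ 0F 2F (begin
  ℓ′ 0F ≡⟨ shared S 0F ⟨
  ℓ 0F  ≡⟨ forced G 0F 3F 4F ⟩
  ℓ 3F  ≡⟨ shared S 3F ⟩
  ℓ′ 3F ≡⟨ forced G′ 3F 2F 4F ⟩
  ℓ′ 2F ∎))
  where open ≡-Reasoning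
gadget-types-distinguished {2F} {3F} {ℓ} {ℓ′} G G′ S = ⊥-elim (right-splits G′ (begin
  ℓ′ 0F ≡⟨ forced G′ 0F 2F 4F ⟩
  ℓ′ 2F ≡⟨ shared S 2F ⟨
  ℓ 2F  ≡⟨ forced G 2F 1F 3F ⟩
  ℓ 1F  ≡⟨ shared S 1F ⟩
  ℓ′ 1F ∎))
  where open ≡-Reasoning
gadget-types-distinguished {0F} {2F} G G′ S = ⊥-elim (right-splits G′ (trans (sym (shared S 0F)) (trans (left-joins G) (shared S 1F))))
gadget-types-distinguished {0F} {3F} G G′ S = ⊥-elim (right-splits G′ (trans (sym (shared S 0F)) (trans (left-joins G) (shared S 1F))))
gadget-types-distinguished {1F} {2F} G G′ S = ⊥-elim (right-splits G′ (trans (sym (shared S 0F)) (trans (left-joins G) (shared S 1F))))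
gadget-types-distinguished {1F} {3F} G G′ S = ⊥-elim (right-splits G′ (trans (sym (shared S 0F)) (trans (left-joins G) (shared S 1F))))
gadget-types-distinguished {1F} {0F} G G′ S = sym (gadget-types-distinguished G′ G (SharedPrefix-sym S))
gadget-types-distinguished {2F} {0F} G G′ S = sym (gadget-types-distinguished G′ G (SharedPrefix-sym S))
gadget-types-distinguished {2F} {1F} G G′ S = sym (gadget-types-distinguished G′ G (SharedPrefix-sym S))
gadget-types-distinguished {3F} {0F} G G′ S = sym (gadget-types-distinguished G′ G (SharedPrefix-sym S))
gadget-types-distinguished {3F} {1F} G G′ S = sym (gadget-types-distinguished G′ G (SharedPrefix-sym S))
gadget-types-distinguished {3F} {2F} G G′ S = sym (gadget-types-distinguished G′ G (SharedPrefix-sym S))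

-- Rows of gadgets

blocks-far : ∀ {g h x y} → g < h → x ≤ 14 → ¬ Near (20 * g + x) (20 * h + y)
blocks-far {g} {h} {x} {y} g<h x≤14 near = ℕ.<⇒≱ far (ℕ.≤-trans (ℕ.m≤n+m∸n b a) (ℕ.+-monoʳ-≤ a b∸a≤4))
  where
  open ℕ.≤-Reasoning
  a b : ℕ
  a = 20 * g + x
  b = 20 * h + y
  b∸a≤4 : b ∸ a ≤ 4
  b∸a≤4 = ℕ.≤-trans (ℕ.m∸n≤∣m-n∣ b a) (near-sym {a} {b} near)
  far : a + 4 < b
  far = begin-strict
    20 * g + x + 4   ≤⟨ ℕ.+-monoˡ-≤ 4 (ℕ.+-monoʳ-≤ (20 * g) x≤14) ⟩
    20 * g + 14 + 4  ≡⟨ ℕ.+-assoc (20 * g) 14 4 ⟩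
    20 * g + 18      <⟨ ℕ.+-monoʳ-< (20 * g) (ℕ.m<m+n 18 {2} ℕ.z<s) ⟩
    20 * g + 20      ≡⟨ ℕ.+-comm (20 * g) 20 ⟩
    20 + 20 * g      ≡⟨ ℕ.*-suc 20 g ⟨
    20 * suc g       ≤⟨ ℕ.*-monoʳ-≤ 20 g<h ⟩
    20 * h           ≤⟨ ℕ.m≤m+n (20 * h) y ⟩
    20 * h + y       ∎

near-blocks⇒≡ : ∀ {g h x y} → x ≤ 14 → y ≤ 14 → Near (20 * g + x) (20 * h + y) → g ≡ h
near-blocks⇒≡ {g} {h} x≤14 y≤14 near with ℕ.<-cmp g h
... | tri< g<h _ _ = ⊥-elim (blocks-far g<h x≤14 near)
... | tri≈ _ g≡h _ = g≡h
... | tri> _ _ h<g = ⊥-elim (blocks-far h<g y≤14 (near-sym {20 * g + _} near))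

at : ∀ {m} → (Fin m → Fin 4) → Fin m → Fin 5 → ℕ
at c g r = 20 * toℕ g + gadget (c g) r

position : ∀ {m} → (Fin m → Fin 4) → Fin (m * 5) → ℕ
position c = uncurry (at c) ∘ Fin.remQuot 5

position-combine : ∀ {m} (c : Fin m → Fin 4) g r → position c (Fin.combine g r) ≡ at c g r
position-combine c g r = cong (uncurry (at c)) (Fin.remQuot-combine g r)

requests : ∀ {d m} → (Fin m → Fin 4) → Seq d
requests c = tabulate (onDiagonal ∘ position c)

offline : ∀ {m} → (Fin m → Fin 4) → Fin (m * 5) → Fin (m * 2)
offline c = uncurry (λ g r → Fin.combine g (cluster (c g) r)) ∘ Fin.remQuot 5

offline-near : ∀ {m} (c : Fin m → Fin 4) s t → offline c s ≡ offline c t → Near (position c s) (position c t)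
offline-near c s t = same-cluster⇒near _ _ _ _
  where
  same-cluster⇒near : ∀ g r g′ r′ → Fin.combine g (cluster (c g) r) ≡ Fin.combine g′ (cluster (c g′) r′) →
                      Near (at c g r) (at c g′ r′)
  same-cluster⇒near g r g′ r′ same
    with refl , same-cluster ← Fin.combine-injective g (cluster (c g) r) g′ (cluster (c g′) r′) same =
    near-+ (20 * toℕ g) (cluster⇒near (c g) r r′ same-cluster)

offline-valid : ∀ {d m} (c : Fin m → Fin 4) → ValidClustering {d} (requests c) (offline c ∘ Fin.cast (length-tabulate _))
offline-valid c = valid-tabulate _ (offline c) λ s t same → near⇒close {a = position c s} {position c t} (offline-near c s t same)

module _ {m} {c : Fin m → Fin 4} {ℓ : Fin (m * 5) → ℕ} (C : Clustering (position c) (m * 2) ℓ) where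
  open Clustering C

  near-at : ∀ {g g′ : Fin m} {a b : Fin 5} → ℓ (Fin.combine g a) ≡ ℓ (Fin.combine g′ b) → Near (at c g a) (at c g′ b)
  near-at same = subst₂ Near (position-combine c _ _) (position-combine c _ _) (near same)

  same-gadget : ∀ {g g′ : Fin m} {a b : Fin 5} → ℓ (Fin.combine g a) ≡ ℓ (Fin.combine g′ b) → g ≡ g′
  same-gadget {g} {g′} {a} {b} same =
    Fin.toℕ-injective (near-blocks⇒≡ (gadget≤14 (c g) a) (gadget≤14 (c g′) b) (near-at same))

  extremes : Fin (m * 2) → Fin (m * 5)
  extremes i = Fin.combine (Fin.quotient {m = m} 2 i) (extreme (Fin.remainder {m = m} 2 i))

  extremes-injective : Injective _≡_ _≡_ (ℓ ∘ extremes)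
  extremes-injective = remQuot-injective {m} 2 ∘ pairs-injective
    where
    pairs-injective : ∀ {g g′ : Fin m} {s s′ : Fin 2} → ℓ (Fin.combine g (extreme s)) ≡ ℓ (Fin.combine g′ (extreme s′)) →
                      (g , s) ≡ (g′ , s′)
    pairs-injective {g} same with refl ← same-gadget same =
      cong (g ,_) (extremes-apart (c g) _ _ (near-+⁻ (20 * toℕ g) (near-at same)))

  -- The 2m extremes already use 2m distinct labels, so no request can have yet another one.
  labelled-as-extreme : ∀ t → ∃ λ i → ℓ t ≡ ℓ (extremes i)
  labelled-as-extreme t with Fin.any? (λ i → ℓ t ℕ.≟ ℓ (extremes i))
  ... | yes found = found
  ... | no none   = ⊥-elim (ℕ.1+n≰n (count (t Vector.∷ extremes) (∷-injective ℓ extremes-injective λ i → none ∘ (i ,_))))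

  labelled-as-own-extreme : ∀ (j : Fin m) r → ∃ λ s → ℓ (Fin.combine j r) ≡ ℓ (Fin.combine j (extreme s))
  labelled-as-own-extreme j r = own (labelled-as-extreme (Fin.combine j r))
    where
    own : ∀ {j : Fin m} → (∃ λ i → ℓ (Fin.combine j r) ≡ ℓ (extremes i)) →
          ∃ λ s → ℓ (Fin.combine j r) ≡ ℓ (Fin.combine j (extreme s))
    own (i , same) with refl ← same-gadget same = Fin.remainder {m = m} 2 i , same

  gadgetClustering : ∀ j → GadgetClustering (c j) (ℓ ∘ Fin.combine j)
  gadgetClustering j = record
    { near       = λ same → near-+⁻ (20 * toℕ j) (near-at same)
    ; two-labels = labelled-as-own-extreme j
    }

at-prefix : ∀ {m} {c c′ : Fin m → Fin 4} {j r} → (∀ g → g Fin.< j → c g ≡ c′ g) →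
            (∀ s → toℕ s ≤ toℕ r → gadget (c j) s ≡ gadget (c′ j) s) →
            ∀ g s → toℕ (Fin.combine g s) ≤ toℕ (Fin.combine j r) → at c g s ≡ at c′ g s
at-prefix {c = c} {c′} {j} {r} below common g s gs≤jr with Fin.<-cmp g j
... | tri< g<j _ _ = cong (λ x → 20 * toℕ g + gadget x s) (below g g<j)
... | tri> _ _ j<g = ⊥-elim (ℕ.<⇒≱ (Fin.combine-monoˡ-< r s j<g) gs≤jr)
... | tri≈ _ refl _ = cong (20 * toℕ g +_) (common s (ℕ.+-cancelˡ-≤ (5 * toℕ g) _ _
  (subst₂ _≤_ (Fin.toℕ-combine g s) (Fin.toℕ-combine g r) gs≤jr)))

position-prefix : ∀ {m} {c c′ : Fin m → Fin 4} {j r} → (∀ g → g Fin.< j → c g ≡ c′ g) →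
                  (∀ s → toℕ s ≤ toℕ r → gadget (c j) s ≡ gadget (c′ j) s) →
                  ∀ t → toℕ t ≤ toℕ (Fin.combine j r) → position c t ≡ position c′ t
position-prefix {m} {c} {c′} below common t t≤jr with g , s , refl ← Fin.combine-surjective {m = m} {n = 5} t = begin
  position c (Fin.combine g s)   ≡⟨ position-combine c g s ⟩
  at c g s                       ≡⟨ at-prefix below common g s t≤jr ⟩
  at c′ g s                      ≡⟨ position-combine c′ g s ⟨
  position c′ (Fin.combine g s)  ∎
  where open ≡-Reasoning

module _ {d} (A : OnlineAlg d) (coordinate : Fin d) where
  open OnlineAlg A

  same-tape⇒same-types : ∀ {m} {c c′ : Fin m → Fin 4} {τ} →
                         ServesWithin A (m * 2) (requests c) τ → ServesWithin A (m * 2) (requests c′) τ →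
                         ∀ g → c g ≡ c′ g
  same-tape⇒same-types {m} {c} {c′} {τ} serves serves′ with first-difference Fin._≟_ c c′
  ... | inj₁ c≗c′ = c≗c′
  ... | inj₂ (j , c≢c′ , below) =
    ⊥-elim (c≢c′ (gadget-types-distinguished (gadgetClustering {c = c} C j) (gadgetClustering {c = c′} C′ j) shared-prefix))
    where
    C : Clustering (position c) (m * 2) (label A (onDiagonal ∘ position c) τ)
    C = servesWithin⇒clustering A (position c) coordinate serves
    C′ : Clustering (position c′) (m * 2) (label A (onDiagonal ∘ position c′) τ)
    C′ = servesWithin⇒clustering A (position c′) coordinate serves′
    shared-prefix : SharedPrefix (c j) (c′ j) (label A (onDiagonal ∘ position c) τ ∘ Fin.combine j)
                                              (label A (onDiagonal ∘ position c′) τ ∘ Fin.combine j)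
    shared-prefix = record
      { agree = λ r common → label-prefix A _ _ τ (Fin.combine j r) λ t t≤jr →
                  cong onDiagonal (position-prefix {c = c} {c′} below common t t≤jr)
      }

  hard-requests : ∀ N → ∃ λ (c : Fin (suc N) → Fin 4) → ∀ τ →
                  ServesWithin A (suc N * 2) (requests c) τ → suc N * 2 ≤ reads (requests c) τ
  hard-requests N = Product.map Fin.finToFun (λ unserved τ serves → ℕ.≰⇒> (unserved τ ∘ (serves ,_)))
    (advice-pigeonhole (suc (N * 2)) R R? R-local R-injective (2^[1+2n]<4^[1+n] N))
    where
    σ : Fin (4 ^ suc N) → Seq d
    σ = requests ∘ Fin.finToFun {4} {suc N}
    R : Fin (4 ^ suc N) → Tape → Set
    R u τ = ServesWithin A (suc N * 2) (σ u) τ × reads (σ u) τ ≤ suc (N * 2)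
    R? : ∀ u τ → Dec (R u τ)
    R? u τ = servesWithin? A _ (σ u) τ ×-dec (reads (σ u) τ ≤? _)
    R-local : ∀ {u τ τ′} → (∀ i → i < suc (N * 2) → τ i ≡ τ′ i) → R u τ → R u τ′
    R-local {u} {τ} {τ′} agree (serves , short) =
      servesWithin-local A agree′ serves , subst (_≤ _) (sym (proj₁ (local (σ u) τ τ′ agree′))) short
      where
      agree′ : ∀ i → i < reads (σ u) τ → τ i ≡ τ′ i
      agree′ i i<reads = agree i (ℕ.<-≤-trans i<reads short)
    R-injective : ∀ {u u′ τ} → R u τ → R u′ τ → u ≡ u′
    R-injective (serves , _) (serves′ , _) = finToFun-injective {4} {suc N} (same-tape⇒same-types serves serves′)

theorem1 : (d : ℕ) → 1 ≤ d → (A : OnlineAlg d) → AlwaysOptimal A →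
    ∀ N → ∃ λ n → N ≤ n × ∃ λ σ → length σ ≡ n ×
      (∀ τ → ServesOptimally A σ τ → AtLeastBound d n (OnlineAlg.reads A σ τ))
theorem1 d 1≤d A _ N =
  suc N * 5 , ℕ.≤-trans (ℕ.n≤1+n N) (ℕ.m≤m*n (suc N) 5) ,
  requests c , length-tabulate (onDiagonal ∘ position c) ,
  λ τ optimal → ≥2m⇒AtLeastBound d (suc N) _ (needs-advice τ (optimal⇒servesWithin A _ (offline-valid c) optimal))
  where
  coordinate : Fin d
  coordinate = Fin.fromℕ< 1≤d
  c : Fin (suc N) → Fin 4
  c = proj₁ (hard-requests A coordinate N)
  needs-advice : ∀ τ → ServesWithin A (suc N * 2) (requests c) τ → suc N * 2 ≤ OnlineAlg.reads A (requests c) τ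
  needs-advice = proj₂ (hard-requests A coordinate N)
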